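{- Let $\Sigma$ be a finite signature of unary predicates containing $\hat T$, and let $\mathfrak{A}$ be any quadratic structure interpreting $\Sigma$ (with $T^\mathfrak{A}$ transitive and $\hat T^\mathfrak{A} = \{a : (a,a)\in T^\mathfrak{A}\}$). Then $\mathcal{C}(\mathfrak{A})$ is a certificate.
   Context: $\Sigma$ is a finite set of unary predicates containing a distinguished unary $\hat T$; $T$ is a distinguished binary predicate, interpreted in structures as a transitive relation, with $\hat T$ interpreted as $\{a:(a,a)\in T\}$. $\Pi_\Sigma$ is the set of fluted 1-types over $\Sigma$ (maximal consistent conjunctions of literals $\pm p(x)$, $p\in\Sigma$); $\mathrm{ftp}^\mathfrak{A}[a]$ is the 1-type realized by $a$. A clique is a maximal set $B$ with $T(a,b)$ for all distinct $a,b\in B$. A clique $B$ is determined by $\{\pi,\pi'\}$ if it is the unique clique in which both are realized; $\mathfrak{A}$ is quadratic if for every clique $B$ determined by some pair $\{\pi,\pi'\}$ there is a 1-type $\pi^*$ such that $B$ is the unique clique in which $\pi^*$ is realized. A clique-type is a function $\xi:\Pi_\Sigma\to\{0,1,2\}$; write $\pi\in\xi$ iff $\xi(\pi)\ge1$ and treat $\xi$ as the set of such $\pi$; $\xi$ is a soliton clique-type if $\neg\hat T$ is a conjunct of some $\pi\in\xi$. A clique-super-type is a pair $(\xi,\Pi)$ with $\xi$ a clique-type and $\Pi\subseteq\Pi_\Sigma$. For $a\in A$ with clique $B$: $\mathrm{ctp}^\mathfrak{A}[a](\pi)$ is $2$, $1$ or $0$ according as $\pi$ is realized by at least two, exactly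 one, or no element of $B$; $\mathrm{cstp}^\mathfrak{A}[a]=(\mathrm{ctp}^\mathfrak{A}[a],\Pi)$ where $\Pi=\{\mathrm{ftp}^\mathfrak{A}[b]: T(a,b)\text{ and not }T(b,a)\}$. A certificate is a triple $\langle\Omega,\ll,V\rangle$ with $\Omega$ a set of clique-super-types, $\ll$ a strict partial order on $\Pi_\Sigma$, $V\subseteq\Pi_\Sigma$, such that: (C1) if $\langle\xi,\Pi\rangle\in\Omega$ and $\pi'\in\Pi$, there is $\langle\xi',\Pi'\rangle\in\Omega$ with $\pi'\in\xi'$, $\Pi'\cup\xi'\subseteq\Pi$ and $\xi\cap V\cap\Pi'=\emptyset$; (C2) if $\langle\xi,\Pi\rangle,\langle\xi',\Pi'\rangle\in\Omega$ are distinct, $\pi\in\xi$, $\pi'\in\xi'$, $\pi\ll\pi'$, then $\xi'\cup\Pi'\subseteq\Pi$; (C3) if $\langle\xi,\Pi\rangle,\langle\xi',\Pi'\rangle\in\Omega$ and $\xi\cap\xi'\cap V\neq\emptyset$ then $\xi=\xi'$ and $\Pi=\Pi'$; (C4) if $\langle\xi,\Pi\rangle\in\Omega$ and $\xi$ is a soliton clique-type, there is $\pi$ with $\xi(\pi)=1$ and $\xi(\pi')=0$ for all $\pi'\neq\pi$; (C5) if $\langle\xi,\Pi\rangle\in\Omega$, $\pi'\in\xi$ and $\pi\ll\pi'$ then $\pi\notin\Pi$; (C6) if $\langle\xi,\Pi\rangle\in\Omega$, $\pi,\pi'\in\xi$ and $\pi\ll\pi'$ then $\xi\cap V\neq\emptyset$.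 The certificate of $\mathfrak{A}$ is $\mathcal{C}(\mathfrak{A})=\langle\Omega,\ll,V\rangle$ where $\Omega=\{\mathrm{cstp}^\mathfrak{A}[a]:a\in A\}$; $\pi\ll\pi'$ iff $\pi,\pi'$ are both realized in $\mathfrak{A}$, $\mathfrak{A}\models\forall x(\pi(x)\rightarrow\forall y(\pi'(y)\rightarrow T(x,y)))$ and $\mathfrak{A}\not\models\forall x(\pi'(x)\rightarrow\forall y(\pi(y)\rightarrow T(x,y)))$; and $V$ is the set of 1-types realized in exactly one clique of $\mathfrak{A}$. -}

module Defs where

open import Level using (Level; 0ℓ) renaming (suc to lsuc)
open import Data.Nat using (ℕ)
open import Data.Fin using (Fin; zero; suc)
open import Data.Bool using (Bool; true; false)
open import Data.Vec using (Vec; lookup; tabulate)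
open import Data.Product using (Σ; ∃; ∃-syntax; _×_; _,_)
open import Data.Sum using (_⊎_)
open import Data.Empty using (⊥)
open import Relation.Nullary using (¬_)
open import Relation.Binary.PropositionalEquality using (_≡_; _≢_; _≗_)
open import Relation.Binary.Structures using (IsStrictPartialOrder)
open import Function.Bundles using (_⇔_)

-- Signature: Σ = Fin n unary predicates, with distinguished t : Fin n
-- standing for T̂.  Fluted 1-types over Σ: one Bool per predicate.

OneType : ℕ → Set
OneType n = Vec Bool n

record Structure (n : ℕ) (t : Fin n) : Set₁ where
  field
    Carrier : Set
    P       : Fin n → Carrier → Bool
    T       : Carrier → Carrier → Set
    T-trans : ∀ {a b c} → T a b → T b c → T a c
    hatT    : ∀ a → (P t a ≡ true) ⇔ T a a

  ftp : Carrier → OneType n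
  ftp a = tabulate (λ p → P p a)

  CSet : Set₁
  CSet = Carrier → Set

  _⊆_ : CSet → CSet → Set
  B ⊆ B' = ∀ a → B a → B' a

  _≐_ : CSet → CSet → Set
  B ≐ B' = (B ⊆ B') × (B' ⊆ B)

  PairwiseT : CSet → Set
  PairwiseT B = ∀ a b → B a → B b → a ≢ b → T a b

  IsClique : CSet → Set₁
  IsClique B = PairwiseT B × (∀ B' → PairwiseT B' → B ⊆ B' → B' ⊆ B)

  RealizedIn : OneType n → CSet → Set
  RealizedIn π B = ∃[ b ] (B b × ftp b ≡ π)

  Realized : OneType n → Set
  Realized π = ∃[ b ] (ftp b ≡ π)

  -- number of realisations of π in B, capped at 2
  Count : CSet → OneType n → Fin 3 → Set
  Count B π zero = ∀ b → B b → ftp b ≢ π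
  Count B π (suc zero) =
    ∃[ b ] (B b × ftp b ≡ π × (∀ c → B c → ftp c ≡ π → c ≡ b))
  Count B π (suc (suc zero)) =
    ∃[ b ] ∃[ c ] (b ≢ c × B b × B c × ftp b ≡ π × ftp c ≡ π)

  -- clique-types and clique-super-types (Π ⊆ Π_Σ given by its
  -- characteristic function)
  CliqueType : Set
  CliqueType = OneType n → Fin 3

  TypeSet : Set
  TypeSet = OneType n → Bool

  IsCtp : Carrier → CliqueType → Set₁
  IsCtp a ξ = ∀ B → IsClique B → B a → ∀ π → Count B π (ξ π)

  IsUpSet : Carrier → TypeSet → Set
  IsUpSet a Π = ∀ π → (Π π ≡ true) ⇔ (∃[ b ] (T a b × ¬ T b a × ftp b ≡ π))

  IsCstp : Carrier → CliqueType → TypeSet → Set₁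
  IsCstp a ξ Π = IsCtp a ξ × IsUpSet a Π

  Ωᴬ : CliqueType → TypeSet → Set₁
  Ωᴬ ξ Π = ∃[ a ] IsCstp a ξ Π

  _≪ᴬ_ : OneType n → OneType n → Set
  π ≪ᴬ π' = Realized π × Realized π'
          × (∀ x → ftp x ≡ π → ∀ y → ftp y ≡ π' → T x y)
          × ¬ (∀ x → ftp x ≡ π' → ∀ y → ftp y ≡ π → T x y)

  Vᴬ : OneType n → Set₁
  Vᴬ π = ∃[ B ] (IsClique B × RealizedIn π B
           × (∀ B' → IsClique B' → RealizedIn π B' → B' ≐ B))

  DeterminedBy : CSet → OneType n → OneType n → Set₁
  DeterminedBy B π π' = RealizedIn π B × RealizedIn π' B
    × (∀ B' → IsClique B' → RealizedIn π B' → RealizedIn π' B' → B' ≐ B)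

  Quadratic : Set₁
  Quadratic = ∀ B → IsClique B → (∃[ π ] ∃[ π' ] DeterminedBy B π π')
    → ∃[ π* ] (RealizedIn π* B
         × (∀ B' → IsClique B' → RealizedIn π* B' → B' ≐ B))

module _ {n : ℕ} (t : Fin n) where

  _∈ξ_ : OneType n → (OneType n → Fin 3) → Set
  π ∈ξ ξ = ξ π ≢ zero

  _∈Π_ : OneType n → (OneType n → Bool) → Set
  π ∈Π Π = Π π ≡ true

  Soliton : (OneType n → Fin 3) → Set
  Soliton ξ = ∃[ π ] (π ∈ξ ξ × lookup π t ≡ false)

  record IsCertificate {ℓ₁ ℓ₂ ℓ₃ : Level}
      (Ω : (OneType n → Fin 3) → (OneType n → Bool) → Set ℓ₁)
      (_≪_ : OneType n → OneType n → Set ℓ₂)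
      (V : OneType n → Set ℓ₃) : Set (ℓ₁ Level.⊔ ℓ₂ Level.⊔ ℓ₃) where
    field
      ≪-spo : IsStrictPartialOrder _≡_ _≪_
      C1 : ∀ ξ Π π' → Ω ξ Π → π' ∈Π Π →
           ∃[ ξ' ] ∃[ Π' ] (Ω ξ' Π' × π' ∈ξ ξ'
             × (∀ π → (π ∈Π Π' ⊎ π ∈ξ ξ') → π ∈Π Π)
             × (∀ π → π ∈ξ ξ → V π → π ∈Π Π' → ⊥))
      C2 : ∀ ξ Π ξ' Π' π π' → Ω ξ Π → Ω ξ' Π' → ¬ (ξ ≗ ξ' × Π ≗ Π') →
           π ∈ξ ξ → π' ∈ξ ξ' → π ≪ π' →
           ∀ π'' → (π'' ∈ξ ξ' ⊎ π'' ∈Π Π') → π'' ∈Π Π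
      C3 : ∀ ξ Π ξ' Π' → Ω ξ Π → Ω ξ' Π' →
           (∃[ π ] (π ∈ξ ξ × π ∈ξ ξ' × V π)) → ξ ≗ ξ' × Π ≗ Π'
      C4 : ∀ ξ Π → Ω ξ Π → Soliton ξ →
           ∃[ π ] (ξ π ≡ suc zero × (∀ π' → π' ≢ π → ξ π' ≡ zero))
      C5 : ∀ ξ Π π π' → Ω ξ Π → π' ∈ξ ξ → π ≪ π' → ¬ (π ∈Π Π)
      C6 : ∀ ξ Π π π' → Ω ξ Π → π ∈ξ ξ → π' ∈ξ ξ → π ≪ π' →
           ∃[ π'' ] (π'' ∈ξ ξ × V π'')

module Submission where

open import Defs
open import Level using (Level; 0ℓ)
open import Data.Nat using (ℕ)
open import Data.Fin using (Fin; zero; suc)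
open import Axiom.ExcludedMiddle using (ExcludedMiddle)
open import Data.Bool using (Bool; true; false)
open import Data.Vec using (lookup)
open import Data.Vec.Properties using (lookup∘tabulate)
open import Data.Product using (∃; ∃-syntax; _×_; _,_; proj₁; proj₂)
open import Data.Sum using (_⊎_; inj₁; inj₂; swap)
open import Data.Empty using (⊥)
open import Function using (const; _∘_)
open import Function.Bundles using (_⇔_; mk⇔; module Equivalence)
open import Relation.Nullary using (¬_; Dec; yes; no; does; contradiction)
open import Relation.Binary.PropositionalEquality
open import Relation.Binary.Structures using (IsStrictPartialOrder)

-- Two elements lie in a common clique iff they are equal or
-- T-related both ways, so (with excluded middle) the cliques are the classes
-- of this equivalence ~, and cstp[a] depends only on the class of a.  The
-- Π-component of cstp[a] collects the types of the elements strictly above a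
-- (a ⊏ b), and ⊏ is transitive and invariant under ~ on either side; each
-- condition then follows by chasing witnesses.  For C6, if π ≪ π' are both
-- realised in the clique of a, every clique realising both contains an element
-- ~-related to a, so the clique is determined by {π, π'} and quadraticity
-- provides a type realised only there.

does-≡true⇔ : ∀ {a} {A : Set a} (a? : Dec A) → (does a? ≡ true) ⇔ A
does-≡true⇔ (yes a) = mk⇔ (const a) (const refl)
does-≡true⇔ (no ¬a) = mk⇔ (λ ()) (λ a → contradiction a ¬a)

≡true-⇔⇒≡ : ∀ {x y : Bool} → (x ≡ true → y ≡ true) → (y ≡ true → x ≡ true) → x ≡ y
≡true-⇔⇒≡ {true}  {true}  _ _ = refl
≡true-⇔⇒≡ {false} {false} _ _ = refl
≡true-⇔⇒≡ {true}  {false} f _ = contradiction (f refl) λ ()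
≡true-⇔⇒≡ {false} {true}  _ g = contradiction (g refl) λ ()

module _ {n : ℕ} {t : Fin n} (𝔄 : Structure n t) where
  open Structure 𝔄
  open Equivalence using (to; from)

  private variable
    a a' b x y z : Carrier
    π π' : OneType n
    B B' B'' : CSet
    ξ ξ' : CliqueType
    Π Π' : TypeSet

  infix 4 _~_ _⊏_

  _~_ : Carrier → Carrier → Set
  a ~ b = a ≡ b ⊎ (T a b × T b a)

  _⊏_ : Carrier → Carrier → Set
  a ⊏ b = T a b × ¬ T b a

  ~-refl : a ~ a
  ~-refl = inj₁ refl

  ~-sym : a ~ b → b ~ a
  ~-sym (inj₁ a≡b)        = inj₁ (sym a≡b)
  ~-sym (inj₂ (Tab , Tba)) = inj₂ (Tba , Tab)

  ~-T-trans : x ~ y → T y z → T x z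
  ~-T-trans (inj₁ refl)      Tyz = Tyz
  ~-T-trans (inj₂ (Txy , _)) Tyz = T-trans Txy Tyz

  T-~-trans : T x y → y ~ z → T x z
  T-~-trans Txy (inj₁ refl)      = Txy
  T-~-trans Txy (inj₂ (Tyz , _)) = T-trans Txy Tyz

  ~-trans : x ~ y → y ~ z → x ~ z
  ~-trans (inj₁ refl) y~z = y~z
  ~-trans (inj₂ (Txy , Tyx)) y~z = inj₂ (T-~-trans Txy y~z , ~-T-trans (~-sym y~z) Tyx)

  ~-≢⇒T : x ~ y → x ≢ y → T x y
  ~-≢⇒T (inj₁ x≡y)      x≢y = contradiction x≡y x≢y
  ~-≢⇒T (inj₂ (Txy , _)) _  = Txy

  ~-of-irreflexive : ¬ T x x → x ~ y → x ≡ y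
  ~-of-irreflexive _    (inj₁ x≡y)        = x≡y
  ~-of-irreflexive ¬Txx (inj₂ (Txy , Tyx)) = contradiction (T-trans Txy Tyx) ¬Txx

  ⊏-trans : x ⊏ y → y ⊏ z → x ⊏ z
  ⊏-trans (Txy , _) (Tyz , ¬Tzy) = T-trans Txy Tyz , λ Tzx → ¬Tzy (T-trans Tzx Txy)

  ~-⊏-trans : x ~ y → y ⊏ z → x ⊏ z
  ~-⊏-trans x~y (Tyz , ¬Tzy) = ~-T-trans x~y Tyz , λ Tzx → ¬Tzy (T-~-trans Tzx x~y)

  ⊏-~-trans : x ⊏ y → y ~ z → x ⊏ z
  ⊏-~-trans (Txy , ¬Tyx) y~z = T-~-trans Txy y~z , λ Tzx → ¬Tyx (~-T-trans y~z Tzx)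

  ftp-≢⇒≢ : ftp x ≡ π → ftp y ≡ π' → π ≢ π' → x ≢ y
  ftp-≢⇒≢ refl refl π≢π' refl = π≢π' refl

  hatT-false⇒¬T-refl : lookup (ftp x) t ≡ false → ¬ T x x
  hatT-false⇒¬T-refl {x} ¬T̂x Txx with () ←
    trans (sym ¬T̂x) (trans (lookup∘tabulate (λ p → P p x) t) (from (hatT x) Txx))

  cliqueOf : Carrier → CSet
  cliqueOf a = a ~_

  cliqueOf-pairwiseT : ∀ a → PairwiseT (cliqueOf a)
  cliqueOf-pairwiseT a x y a~x a~y = ~-≢⇒T (~-trans (~-sym a~x) a~y)

  ≐-sym : B ≐ B' → B' ≐ B
  ≐-sym (B⊆B' , B'⊆B) = B'⊆B , B⊆B'

  ≐-trans : B ≐ B' → B' ≐ B'' → B ≐ B''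
  ≐-trans (B⊆B' , B'⊆B) (B'⊆B'' , B''⊆B') =
    (λ z Bz → B'⊆B'' z (B⊆B' z Bz)) , (λ z B''z → B'⊆B z (B''⊆B' z B''z))

  ~⇒cliqueOf-≐ : x ~ y → cliqueOf x ≐ cliqueOf y
  ~⇒cliqueOf-≐ x~y = (λ _ → ~-trans (~-sym x~y)) , (λ _ → ~-trans x~y)

  Count-resp-≐ : ∀ k → B ≐ B' → Count B π k → Count B' π k
  Count-resp-≐ zero (_ , B'⊆B) none b B'b = none b (B'⊆B b B'b)
  Count-resp-≐ (suc zero) (B⊆B' , B'⊆B) (b , Bb , e , unique) =
    b , B⊆B' b Bb , e , λ c B'c ec → unique c (B'⊆B c B'c) ec
  Count-resp-≐ (suc (suc zero)) (B⊆B' , _) (b , c , b≢c , Bb , Bc , eb , ec) =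
    b , c , b≢c , B⊆B' b Bb , B⊆B' c Bc , eb , ec

  Count-suc⇒RealizedIn : ∀ k → Count B π (suc k) → RealizedIn π B
  Count-suc⇒RealizedIn zero       (b , Bb , e , _)         = b , Bb , e
  Count-suc⇒RealizedIn (suc zero) (b , _ , _ , Bb , _ , e , _) = b , Bb , e

  Count-nonzero⇒RealizedIn : ∀ k → k ≢ zero → Count B π k → RealizedIn π B
  Count-nonzero⇒RealizedIn zero    k≢0 _ = contradiction refl k≢0
  Count-nonzero⇒RealizedIn (suc k) _     = Count-suc⇒RealizedIn k

  Count-once⇒¬twice : Count B π (suc zero) → ¬ Count B π (suc (suc zero))
  Count-once⇒¬twice (_ , _ , _ , unique) (c , d , c≢d , Bc , Bd , ec , ed) =
    c≢d (trans (unique c Bc ec) (sym (unique d Bd ed)))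

  Count-functional : ∀ k k' → Count B π k → Count B π k' → k ≡ k'
  Count-functional zero zero _ _ = refl
  Count-functional zero (suc k') none count
    with b , Bb , e ← Count-suc⇒RealizedIn k' count = contradiction e (none b Bb)
  Count-functional (suc k) zero count none = sym (Count-functional zero (suc k) none count)
  Count-functional (suc zero) (suc zero) _ _ = refl
  Count-functional (suc zero) (suc (suc zero)) once twice =
    contradiction twice (Count-once⇒¬twice once)
  Count-functional (suc (suc zero)) (suc zero) twice once =
    contradiction twice (Count-once⇒¬twice once)
  Count-functional (suc (suc zero)) (suc (suc zero)) _ _ = refl

  upSet-member : IsUpSet a Π → Π π ≡ true → ∃[ b ] (a ⊏ b × ftp b ≡ π)
  upSet-member up π∈Π with b , Tab , ¬Tba , e ← to (up _) π∈Π = b , (Tab , ¬Tba) , e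

  upSet-complete : IsUpSet a Π → a ⊏ b → ftp b ≡ π → Π π ≡ true
  upSet-complete up (Tab , ¬Tba) e = from (up _) (_ , Tab , ¬Tba , e)

  upSet-resp-~ : a ~ a' → IsUpSet a Π → IsUpSet a' Π' → Π π ≡ true → Π' π ≡ true
  upSet-resp-~ a~a' up up' π∈Π with b , a⊏b , e ← upSet-member up π∈Π =
    upSet-complete up' (~-⊏-trans (~-sym a~a') a⊏b) e

  ≪ᴬ-irrefl : ¬ π ≪ᴬ π
  ≪ᴬ-irrefl (_ , _ , π→π , π↛π) = π↛π π→π

  ≪ᴬ-trans : ∀ {π₁ π₂ π₃} → π₁ ≪ᴬ π₂ → π₂ ≪ᴬ π₃ → π₁ ≪ᴬ π₃
  ≪ᴬ-trans (real₁ , (w , ew) , π₁→π₂ , π₂↛π₁) (_ , real₃@(y , ey) , π₂→π₃ , _) =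
    real₁ , real₃ , (λ x ex z ez → T-trans (π₁→π₂ x ex w ew) (π₂→π₃ w ew z ez))
    , λ π₃→π₁ → π₂↛π₁ λ w' ew' x ex → T-trans (π₂→π₃ w' ew' y ey) (π₃→π₁ y ey x ex)

  ≪ᴬ-isStrictPartialOrder : IsStrictPartialOrder _≡_ _≪ᴬ_
  ≪ᴬ-isStrictPartialOrder = record
    { isEquivalence = isEquivalence
    ; irrefl        = λ { refl → ≪ᴬ-irrefl }
    ; trans         = ≪ᴬ-trans
    ; <-resp-≈      = (λ { refl p → p }) , (λ { refl p → p })
    }

  module _ (em : ExcludedMiddle 0ℓ) where

    pairwiseT⇒~ : PairwiseT B → B x → B y → x ~ y
    pairwiseT⇒~ {x = x} {y} pw Bx By with em {x ≡ y}
    ... | yes x≡y = inj₁ x≡y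
    ... | no  x≢y = inj₂ (pw x y Bx By x≢y , pw y x By Bx (x≢y ∘ sym))

    cliqueOf-isClique : ∀ a → IsClique (cliqueOf a)
    cliqueOf-isClique a =
      cliqueOf-pairwiseT a , λ B pw B⊇ z → pairwiseT⇒~ pw (B⊇ a ~-refl)

    clique≐cliqueOf : IsClique B → B a → B ≐ cliqueOf a
    clique≐cliqueOf {B} (pw , maximal) Ba =
      B⊆ , maximal _ (cliqueOf-pairwiseT _) B⊆
      where
      B⊆ : B ⊆ cliqueOf _
      B⊆ z = pairwiseT⇒~ pw Ba

    Count-total : ∀ B π → ∃ (Count B π)
    Count-total B π with em {Count B π (suc (suc zero))}
    ... | yes twice = suc (suc zero) , twice
    ... | no ¬twice with em {RealizedIn π B}
    ...   | no ¬real = zero , λ b Bb e → ¬real (b , Bb , e)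
    ...   | yes (b , Bb , e) = suc zero , b , Bb , e , unique
      where
      unique : ∀ c → B c → ftp c ≡ π → c ≡ b
      unique c Bc ec with em {c ≡ b}
      ... | yes c≡b = c≡b
      ... | no  c≢b = contradiction (c , b , c≢b , Bc , Bb , ec , e) ¬twice

    ctp : Carrier → CliqueType
    ctp a π = proj₁ (Count-total (cliqueOf a) π)

    up : Carrier → TypeSet
    up a π = does (em {∃[ b ] (T a b × ¬ T b a × ftp b ≡ π)})

    isCtp-ctp : ∀ a → IsCtp a (ctp a)
    isCtp-ctp a B clique Ba π =
      Count-resp-≐ _ (≐-sym (clique≐cliqueOf clique Ba)) (proj₂ (Count-total (cliqueOf a) π))

    isUpSet-up : ∀ a → IsUpSet a (up a)
    isUpSet-up a π = does-≡true⇔ em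

    Ωᴬ-cstp : ∀ a → Ωᴬ (ctp a) (up a)
    Ωᴬ-cstp a = a , isCtp-ctp a , isUpSet-up a

    isCtp-count : IsCtp a ξ → ∀ π → Count (cliqueOf a) π (ξ π)
    isCtp-count {a} ctpa = ctpa (cliqueOf a) (cliqueOf-isClique a) ~-refl

    ctp-member⇒realized : IsCtp a ξ → ξ π ≢ zero → ∃[ x ] (a ~ x × ftp x ≡ π)
    ctp-member⇒realized {ξ = ξ} {π} ctpa = λ π∈ξ →
      Count-nonzero⇒RealizedIn (ξ π) π∈ξ (isCtp-count ctpa π)

    realized⇒ctp-member : IsCtp a ξ → a ~ x → ftp x ≡ π → ξ π ≢ zero
    realized⇒ctp-member ctpa a~x e π∉ξ =
      subst (Count _ _) π∉ξ (isCtp-count ctpa _) _ a~x e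

    isCstp-~-unique : a ~ a' → IsCstp a ξ Π → IsCstp a' ξ' Π' → ξ ≗ ξ' × Π ≗ Π'
    isCstp-~-unique {a} a~a' (ctpa , upa) (ctpa' , upa') =
      (λ π → Count-functional _ _ (isCtp-count ctpa π)
                                  (ctpa' (cliqueOf a) (cliqueOf-isClique a) a~a' π))
      , λ π → ≡true-⇔⇒≡ (upSet-resp-~ a~a' upa upa') (upSet-resp-~ (~-sym a~a') upa' upa)

    Vᴬ-unique-clique : Vᴬ π → a ~ x → ftp x ≡ π → a' ~ y → ftp y ≡ π → a ~ a'
    Vᴬ-unique-clique {a = a} {a' = a'} (_ , _ , _ , unique) a~x ex a'~y ey =
      proj₂ (unique (cliqueOf a) (cliqueOf-isClique a) (_ , a~x , ex)) a'
        (proj₁ (unique (cliqueOf a') (cliqueOf-isClique a') (_ , a'~y , ey)) a' ~-refl)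

    upSet-⊇-⊏-cstp : IsUpSet a Π → IsCstp b ξ' Π' → a ⊏ b →
                     ∀ π → ξ' π ≢ zero ⊎ Π' π ≡ true → Π π ≡ true
    upSet-⊇-⊏-cstp upa (ctpb , _) a⊏b π (inj₁ π∈ξ')
      with c , b~c , e ← ctp-member⇒realized ctpb π∈ξ' = upSet-complete upa (⊏-~-trans a⊏b b~c) e
    upSet-⊇-⊏-cstp upa (_ , upb) a⊏b π (inj₂ π∈Π')
      with c , b⊏c , e ← upSet-member upb π∈Π' = upSet-complete upa (⊏-trans a⊏b b⊏c) e

    ≪ᴬ-distinct-cstp⇒⊏ : IsCstp a ξ Π → IsCstp a' ξ' Π' → ¬ (ξ ≗ ξ' × Π ≗ Π') →
                        ξ π ≢ zero → ξ' π' ≢ zero → π ≪ᴬ π' → a ⊏ a'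
    ≪ᴬ-distinct-cstp⇒⊏ cstpa@(ctpa , _) cstpa'@(ctpa' , _) distinct π∈ξ π'∈ξ' (_ , _ , π→π' , _)
      with x , a~x , ex ← ctp-member⇒realized ctpa π∈ξ
         | y , a'~y , ey ← ctp-member⇒realized ctpa' π'∈ξ'
      = Taa' , λ Ta'a → distinct (isCstp-~-unique (inj₂ (Taa' , Ta'a)) cstpa cstpa')
      where
      Taa' = T-~-trans (~-T-trans a~x (π→π' x ex y ey)) (~-sym a'~y)

    ≪ᴬ⇒DeterminedBy : a ~ x → ftp x ≡ π → a ~ y → ftp y ≡ π' → π ≪ᴬ π' →
                      DeterminedBy (cliqueOf a) π π'
    ≪ᴬ⇒DeterminedBy {a} {x} {π} {y} {π'} a~x ex a~y ey π≪π'@(_ , _ , π→π' , _) =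
      (x , a~x , ex) , (y , a~y , ey) , λ B' clique (x' , B'x' , ex') (y' , B'y' , ey') →
        let Ty'x' = proj₁ clique y' x' B'y' B'x' (ftp-≢⇒≢ ey' ex' π'≢π)
            a~y' = ~-trans a~x (inj₂ (π→π' x ex y' ey' ,
                     T-trans (T-trans Ty'x' (π→π' x' ex' y ey)) Tyx))
        in ≐-trans (clique≐cliqueOf clique B'y') (~⇒cliqueOf-≐ (~-sym a~y'))
      where
      π'≢π : π' ≢ π
      π'≢π π'≡π = ≪ᴬ-irrefl (subst (π ≪ᴬ_) π'≡π π≪π')
      Tyx : T y x
      Tyx = ~-≢⇒T (~-trans (~-sym a~y) a~x) (ftp-≢⇒≢ ey ex π'≢π)

    Ωᴬ-C1 : ∀ ξ Π π' → Ωᴬ ξ Π → Π π' ≡ true →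
            ∃[ ξ' ] ∃[ Π' ] (Ωᴬ ξ' Π' × ξ' π' ≢ zero
              × (∀ π → Π' π ≡ true ⊎ ξ' π ≢ zero → Π π ≡ true)
              × (∀ π → ξ π ≢ zero → Vᴬ π → Π' π ≡ true → ⊥))
    Ωᴬ-C1 ξ Π π' (a , ctpa , upa) π'∈Π with b , a⊏b , eb ← upSet-member upa π'∈Π =
      ctp b , up b , Ωᴬ-cstp b , realized⇒ctp-member (isCtp-ctp b) ~-refl eb
      , (λ π → upSet-⊇-⊏-cstp upa (isCtp-ctp b , isUpSet-up b) a⊏b π ∘ swap)
      , disjoint
      where
      disjoint : ∀ π → ξ π ≢ zero → Vᴬ π → up b π ≡ true → ⊥
      disjoint π π∈ξ v π∈Πb
        with x , a~x , ex ← ctp-member⇒realized ctpa π∈ξ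
           | c , b⊏c , ec ← upSet-member (isUpSet-up b) π∈Πb
        = proj₂ a⊏b (proj₁ (⊏-~-trans b⊏c (~-sym (Vᴬ-unique-clique v a~x ex ~-refl ec))))

    Ωᴬ-C2 : ∀ ξ Π ξ' Π' π π' → Ωᴬ ξ Π → Ωᴬ ξ' Π' → ¬ (ξ ≗ ξ' × Π ≗ Π') →
            ξ π ≢ zero → ξ' π' ≢ zero → π ≪ᴬ π' →
            ∀ π'' → ξ' π'' ≢ zero ⊎ Π' π'' ≡ true → Π π'' ≡ true
    Ωᴬ-C2 _ _ _ _ _ _ (a , cstpa@(_ , upa)) (a' , cstpa') distinct π∈ξ π'∈ξ' π≪π' =
      upSet-⊇-⊏-cstp upa cstpa' (≪ᴬ-distinct-cstp⇒⊏ cstpa cstpa' distinct π∈ξ π'∈ξ' π≪π')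

    Ωᴬ-C3 : ∀ ξ Π ξ' Π' → Ωᴬ ξ Π → Ωᴬ ξ' Π' →
            ∃[ π ] (ξ π ≢ zero × ξ' π ≢ zero × Vᴬ π) → ξ ≗ ξ' × Π ≗ Π'
    Ωᴬ-C3 _ _ _ _ (a , cstpa@(ctpa , _)) (a' , cstpa'@(ctpa' , _)) (π , π∈ξ , π∈ξ' , v)
      with x , a~x , ex ← ctp-member⇒realized ctpa π∈ξ
         | y , a'~y , ey ← ctp-member⇒realized ctpa' π∈ξ'
      = isCstp-~-unique (Vᴬ-unique-clique v a~x ex a'~y ey) cstpa cstpa'

    Ωᴬ-C4 : ∀ ξ Π → Ωᴬ ξ Π → ∃[ π ] (ξ π ≢ zero × lookup π t ≡ false) →
            ∃[ π ] (ξ π ≡ suc zero × (∀ π' → π' ≢ π → ξ π' ≡ zero))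
    Ωᴬ-C4 ξ _ (a , ctpa , _) (π , π∈ξ , ¬T̂π)
      with x , a~x , refl ← ctp-member⇒realized ctpa π∈ξ
      = ftp x , Count-functional _ _ (isCtp-count ctpa (ftp x)) once
      , λ π' π'≢ → Count-functional _ _ (isCtp-count ctpa π') (none π' π'≢)
      where
      only-x : ∀ z → a ~ z → z ≡ x
      only-x z a~z = sym (~-of-irreflexive (hatT-false⇒¬T-refl ¬T̂π) (~-trans (~-sym a~x) a~z))
      once : Count (cliqueOf a) (ftp x) (suc zero)
      once = x , a~x , refl , λ z a~z _ → only-x z a~z
      none : ∀ π' → π' ≢ ftp x → Count (cliqueOf a) π' zero
      none π' π'≢ z a~z ez = π'≢ (trans (sym ez) (cong ftp (only-x z a~z)))

    Ωᴬ-C5 : ∀ ξ Π π π' → Ωᴬ ξ Π → ξ π' ≢ zero → π ≪ᴬ π' → ¬ (Π π ≡ true)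
    Ωᴬ-C5 _ _ _ _ (a , ctpa , upa) π'∈ξ (_ , _ , π→π' , _) π∈Π
      with b , a⊏b , eb ← upSet-member upa π∈Π
         | y , a~y , ey ← ctp-member⇒realized ctpa π'∈ξ
      = proj₂ a⊏b (T-~-trans (π→π' b eb y ey) (~-sym a~y))

    Ωᴬ-C6 : Quadratic → ∀ ξ Π π π' → Ωᴬ ξ Π → ξ π ≢ zero → ξ π' ≢ zero → π ≪ᴬ π' →
            ∃[ π'' ] (ξ π'' ≢ zero × Vᴬ π'')
    Ωᴬ-C6 quad _ _ π π' (a , ctpa , _) π∈ξ π'∈ξ π≪π'
      with x , a~x , ex ← ctp-member⇒realized ctpa π∈ξ
         | y , a~y , ey ← ctp-member⇒realized ctpa π'∈ξ
      with π* , (z , a~z , ez) , unique ←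
             quad (cliqueOf a) (cliqueOf-isClique a) (π , π' , ≪ᴬ⇒DeterminedBy a~x ex a~y ey π≪π')
      = π* , realized⇒ctp-member ctpa a~z ez
      , cliqueOf a , cliqueOf-isClique a , (z , a~z , ez) , unique

    certificate : Quadratic → IsCertificate t Ωᴬ _≪ᴬ_ Vᴬ
    certificate quad = record
      { ≪-spo = ≪ᴬ-isStrictPartialOrder
      ; C1 = Ωᴬ-C1 ; C2 = Ωᴬ-C2 ; C3 = Ωᴬ-C3 ; C4 = Ωᴬ-C4 ; C5 = Ωᴬ-C5 ; C6 = Ωᴬ-C6 quad
      }

lemma3p4 : ({ℓ : Level} → ExcludedMiddle ℓ) →
    (n : ℕ) (t : Fin n) (𝔄 : Structure n t) →
    Structure.Quadratic 𝔄 →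
    IsCertificate t (Structure.Ωᴬ 𝔄) (Structure._≪ᴬ_ 𝔄) (Structure.Vᴬ 𝔄)
lemma3p4 em n t 𝔄 = certificate 𝔄 em
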